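{- For every finite simple graph $G$ and every integer $k\ge1$, the $k$-supertoken graph satisfies $\chi(\mathcal F_k(G))=\chi(G)$.
   Context: The $k$-supertoken graph $\mathcal F_k(G)$ has as vertices all multisets of size $k$ of elements of $V(G)$; two multisets $A,B$ are adjacent iff $A=S\uplus\{u\}$, $B=S\uplus\{v\}$ for some multiset $S$ of size $k-1$ and some edge $uv\in E(G)$, where $\uplus$ is multiset sum. $\chi$ denotes the chromatic number. -}

module Defs where

open import Data.Nat using (ℕ; zero; suc; _+_; _≤_)
open import Data.Fin using (Fin; zero; suc; _≟_)
open import Data.Product using (Σ; ∃; ∃-syntax; _×_; _,_; proj₁)
open import Relation.Nullary using (¬_; yes; no)
open import Relation.Binary.PropositionalEquality using (_≡_)

record SimpleGraph (n : ℕ) : Set₁ where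
  field
    Adj   : Fin n → Fin n → Set
    sym   : ∀ {u v} → Adj u v → Adj v u
    irrefl : ∀ {u} → ¬ Adj u u

record Graph : Set₁ where
  field
    V   : Set
    Adj : V → V → Set

toGraph : ∀ {n} → SimpleGraph n → Graph
toGraph {n} G = record { V = Fin n ; Adj = SimpleGraph.Adj G }

ProperColoring : (G : Graph) (c : ℕ) → (Graph.V G → Fin c) → Set
ProperColoring G c f = ∀ {x y} → Graph.Adj G x y → ¬ (f x ≡ f y)

Colorable : Graph → ℕ → Set
Colorable G c = Σ (Graph.V G → Fin c) (ProperColoring G c)

IsChromaticNumber : Graph → ℕ → Set
IsChromaticNumber G m = Colorable G m × (∀ c → Colorable G c → m ≤ c)

sumFin : ∀ {n} → (Fin n → ℕ) → ℕ
sumFin {zero}  f = 0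
sumFin {suc n} f = f zero + sumFin (λ i → f (suc i))

Multiset : ℕ → Set
Multiset n = Fin n → ℕ

Multiset[_,_] : ℕ → ℕ → Set
Multiset[ n , k ] = Σ (Multiset n) (λ m → sumFin m ≡ k)

single : ∀ {n} → Fin n → Multiset n
single u i with u ≟ i
... | yes _ = 1
... | no  _ = 0

_⊎ₘ_ : ∀ {n} → Multiset n → Multiset n → Multiset n
(S ⊎ₘ T) i = S i + T i

-- The k-supertoken graph F_k(G): vertices are the multisets of size k over V(G);
-- A ~ B iff A = S ⊎ {u}, B = S ⊎ {v} for some multiset S (of size k-1,
-- forced by the sizes) and some edge uv of G.
supertoken : ∀ {n} → SimpleGraph n → ℕ → Graph
supertoken {n} G k = record
  { V   = Multiset[ n , k ]
  ; Adj = λ A B → ∃[ S ] ∃[ u ] ∃[ v ]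
            (SimpleGraph.Adj G u v
             × (∀ i → proj₁ A i ≡ (S ⊎ₘ single u) i)
             × (∀ i → proj₁ B i ≡ (S ⊎ₘ single v) i))
  }

-- A proper c-colouring f of G induces one of F_k(G): colour a multiset A by
-- Σᵢ A(i)·f(i) mod c. Adjacent multisets S ⊎ {u} and S ⊎ {v} get colours
-- differing by f(u) − f(v) mod c, which is nonzero since 0 ≤ f(u), f(v) < c.
-- Conversely u ↦ (k − 1)·{w} ⊎ {u}, for a fixed vertex w, embeds G into F_k(G).
module Submission where

open import Defs
open import Data.Nat using (ℕ; _≥_)
open import Function.Bundles using (_⇔_)

open import Data.Empty using (⊥-elim)
open import Data.Fin as Fin using (Fin; zero; suc; toℕ; fromℕ<)
open import Data.Fin.Properties using (toℕ-fromℕ<; toℕ-injective; toℕ<n; ¬Fin0) renaming (suc-injective to Fin-suc-injective)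
open import Data.Nat using (zero; suc; _+_; _*_; _∸_; _<_; NonZero)
open import Data.Nat.DivMod using (_%_; _/_; m≡m%n+[m/n]*n; m%n%n≡m%n; m%n<n; m%n≤n; %-distribˡ-+; %-remove-+ʳ; m<n⇒m%n≡m)
open import Data.Nat.Divisibility using (_∣_; divides)
open import Data.Nat.Properties
open import Algebra.Properties.Semiring.Sum +-*-semiring using (sum; sum-cong-≗; sum-replicate-zero; ∑-distrib-+)
open import Data.Product using (_,_; proj₁)
open import Function.Base using (_∘_; const)
open import Function.Bundles using (mk⇔)
open import Relation.Binary.PropositionalEquality
open import Relation.Nullary using (yes; no)

open Graph

record GraphHom (X Y : Graph) : Set where
  field
    vertexMap : V X → V Y
    preserves : ∀ {x y} → Adj X x y → Adj Y (vertexMap x) (vertexMap y)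

colorable-pullback : ∀ {X Y c} → GraphHom X Y → Colorable Y c → Colorable X c
colorable-pullback φ (f , proper) = f ∘ vertexMap , proper ∘ preserves
  where open GraphHom φ

isChromaticNumber-⇔ : ∀ {X Y} → (∀ c → Colorable X c → Colorable Y c) →
                      (∀ c → Colorable Y c → Colorable X c) →
                      ∀ m → IsChromaticNumber X m ⇔ IsChromaticNumber Y m
isChromaticNumber-⇔ X⇒Y Y⇒X m = mk⇔ (transfer X⇒Y Y⇒X) (transfer Y⇒X X⇒Y)
  where
  transfer : ∀ {X Y} → (∀ c → Colorable X c → Colorable Y c) →
             (∀ c → Colorable Y c → Colorable X c) →
             IsChromaticNumber X m → IsChromaticNumber Y m
  transfer X⇒Y Y⇒X (colorable , minimal) = X⇒Y m colorable , λ c → minimal c ∘ Y⇒X c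

sumFin≡sum : ∀ {n} (f : Fin n → ℕ) → sumFin f ≡ sum f
sumFin≡sum {zero}  f = refl
sumFin≡sum {suc n} f = cong (f zero +_) (sumFin≡sum (f ∘ suc))

sumFin-cong : ∀ {n} {f g : Fin n → ℕ} → (∀ i → f i ≡ g i) → sumFin f ≡ sumFin g
sumFin-cong {f = f} {g} f≗g = begin
  sumFin f ≡⟨ sumFin≡sum f ⟩
  sum f    ≡⟨ sum-cong-≗ f≗g ⟩
  sum g    ≡⟨ sumFin≡sum g ⟨
  sumFin g ∎
  where open ≡-Reasoning

sumFin-+ : ∀ {n} (f g : Fin n → ℕ) → sumFin (λ i → f i + g i) ≡ sumFin f + sumFin g
sumFin-+ f g = begin
  sumFin (λ i → f i + g i) ≡⟨ sumFin≡sum (λ i → f i + g i) ⟩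
  sum (λ i → f i + g i)    ≡⟨ ∑-distrib-+ f g ⟩
  sum f + sum g            ≡⟨ cong₂ _+_ (sumFin≡sum f) (sumFin≡sum g) ⟨
  sumFin f + sumFin g      ∎
  where open ≡-Reasoning

weight : ∀ {n} → (Fin n → ℕ) → Multiset n → ℕ
weight w A = sumFin (λ i → A i * w i)

weight-⊎ₘ : ∀ {n} (w : Fin n → ℕ) S T → weight w (S ⊎ₘ T) ≡ weight w S + weight w T
weight-⊎ₘ w S T = trans (sumFin-cong (λ i → *-distribʳ-+ (w i) (S i) (T i)))
                        (sumFin-+ (λ i → S i * w i) (λ i → T i * w i))

single-suc : ∀ {n} (u i : Fin n) → single (suc u) (suc i) ≡ single u i
single-suc u i with suc u Fin.≟ suc i | u Fin.≟ i
... | yes _     | yes _     = refl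
... | no  _     | no  _     = refl
... | yes su≡si | no  u≢i   = ⊥-elim (u≢i (Fin-suc-injective su≡si))
... | no  su≢si | yes u≡i   = ⊥-elim (su≢si (cong suc u≡i))

weight-single : ∀ {n} (w : Fin n → ℕ) u → weight w (single u) ≡ w u
weight-single {suc n} w zero    = begin
  w zero + 0 + sumFin {n} (const 0) ≡⟨ cong (w zero + 0 +_) (sumFin≡sum {n} (const 0)) ⟩
  w zero + 0 + sum {n} (const 0)    ≡⟨ cong (w zero + 0 +_) (sum-replicate-zero n) ⟩
  w zero + 0 + 0                    ≡⟨ cong (_+ 0) (+-identityʳ (w zero)) ⟩
  w zero + 0                        ≡⟨ +-identityʳ (w zero) ⟩
  w zero                            ∎
  where open ≡-Reasoning
weight-single {suc n} w (suc u) = trans (sumFin-cong (λ i → cong (_* w (suc i)) (single-suc u i)))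
                                        (weight-single (w ∘ suc) u)

weight-cong : ∀ {n} (w : Fin n → ℕ) {A B : Multiset n} → (∀ i → A i ≡ B i) → weight w A ≡ weight w B
weight-cong w A≗B = sumFin-cong (λ i → cong (_* w i) (A≗B i))

%-absorbˡ : ∀ m o c .{{_ : NonZero c}} → (m % c + o) % c ≡ (m + o) % c
%-absorbˡ m o c = begin
  (m % c + o) % c         ≡⟨ %-distribˡ-+ (m % c) o c ⟩
  (m % c % c + o % c) % c ≡⟨ cong (λ r → (r + o % c) % c) (m%n%n≡m%n m c) ⟩
  (m % c + o % c) % c     ≡⟨ %-distribˡ-+ m o c ⟨
  (m + o) % c             ∎
  where open ≡-Reasoning

∣m+[n∸m%n] : ∀ m n .{{_ : NonZero n}} → n ∣ m + (n ∸ m % n)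
∣m+[n∸m%n] m n = divides (suc q) (begin
  m + (n ∸ r)         ≡⟨ cong (_+ (n ∸ r)) (m≡m%n+[m/n]*n m n) ⟩
  r + q * n + (n ∸ r) ≡⟨ cong (_+ (n ∸ r)) (+-comm r (q * n)) ⟩
  q * n + r + (n ∸ r) ≡⟨ +-assoc (q * n) r (n ∸ r) ⟩
  q * n + (r + (n ∸ r)) ≡⟨ cong (q * n +_) (m+[n∸m]≡n (m%n≤n m n)) ⟩
  q * n + n           ≡⟨ +-comm (q * n) n ⟩
  suc q * n           ∎)
  where
  open ≡-Reasoning
  q = m / n
  r = m % n

+-%-cancelˡ : ∀ y {x} n .{{_ : NonZero n}} → x < n → ((y + x) % n + (n ∸ y % n)) % n ≡ x
+-%-cancelˡ y {x} n x<n = begin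
  ((y + x) % n + t) % n ≡⟨ %-absorbˡ (y + x) t n ⟩
  (y + x + t) % n       ≡⟨ cong (_% n) (cong (_+ t) (+-comm y x)) ⟩
  (x + y + t) % n       ≡⟨ cong (_% n) (+-assoc x y t) ⟩
  (x + (y + t)) % n     ≡⟨ %-remove-+ʳ x (∣m+[n∸m%n] y n) ⟩
  x % n                 ≡⟨ m<n⇒m%n≡m x<n ⟩
  x                     ∎
  where
  open ≡-Reasoning
  t = n ∸ y % n

+-%-injectiveˡ : ∀ y n .{{_ : NonZero n}} {a b} → a < n → b < n → (y + a) % n ≡ (y + b) % n → a ≡ b
+-%-injectiveˡ y n {a} {b} a<n b<n eq = begin
  a                               ≡⟨ +-%-cancelˡ y n a<n ⟨
  ((y + a) % n + (n ∸ y % n)) % n ≡⟨ cong (λ r → (r + (n ∸ y % n)) % n) eq ⟩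
  ((y + b) % n + (n ∸ y % n)) % n ≡⟨ +-%-cancelˡ y n b<n ⟩
  b                               ∎
  where open ≡-Reasoning

someElement : ∀ {n k} → k ≥ 1 → Multiset[ n , k ] → Fin n
someElement {zero}  () (_ , refl)
someElement {suc n} _  _ = zero

weight-≗⊎ₘsingle : ∀ {n} (w : Fin n → ℕ) {A S : Multiset n} {u} →
                   (∀ i → A i ≡ (S ⊎ₘ single u) i) → weight w A ≡ weight w S + w u
weight-≗⊎ₘsingle w {A} {S} {u} A≗S⊎u = begin
  weight w A                          ≡⟨ weight-cong w A≗S⊎u ⟩
  weight w (S ⊎ₘ single u)            ≡⟨ weight-⊎ₘ w S (single u) ⟩
  weight w S + weight w (single u)    ≡⟨ cong (weight w S +_) (weight-single w u) ⟩
  weight w S + w u                    ∎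
  where open ≡-Reasoning

supertoken-colorable : ∀ {n} (G : SimpleGraph n) {k} → k ≥ 1 →
                       ∀ c → Colorable (toGraph G) c → Colorable (supertoken G k) c
supertoken-colorable G k≥1 zero    (f , _) =
  f ∘ someElement k≥1 , λ {A} _ _ → ¬Fin0 (f (someElement k≥1 A))
supertoken-colorable {n} G {k} k≥1 c@(suc _) (f , proper) = colour , λ {A} {B} → colour-proper {A} {B}
  where
  w : Fin n → ℕ
  w = toℕ ∘ f

  colour : Multiset[ n , k ] → Fin c
  colour (A , _) = fromℕ< (m%n<n (weight w A) c)

  toℕ-colour : ∀ A → toℕ (colour A) ≡ weight w (proj₁ A) % c
  toℕ-colour (A , _) = toℕ-fromℕ< (m%n<n (weight w A) c)

  colour-proper : ProperColoring (supertoken G k) c colour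
  colour-proper {A} {B} (S , u , v , uv , A≗S⊎u , B≗S⊎v) colourA≡colourB =
    proper uv (toℕ-injective (+-%-injectiveˡ (weight w S) c (toℕ<n (f u)) (toℕ<n (f v)) (begin
      (weight w S + w u) % c  ≡⟨ cong (_% c) (weight-≗⊎ₘsingle w A≗S⊎u) ⟨
      weight w (proj₁ A) % c  ≡⟨ toℕ-colour A ⟨
      toℕ (colour A)          ≡⟨ cong toℕ colourA≡colourB ⟩
      toℕ (colour B)          ≡⟨ toℕ-colour B ⟩
      weight w (proj₁ B) % c  ≡⟨ cong (_% c) (weight-≗⊎ₘsingle w B≗S⊎v) ⟩
      (weight w S + w v) % c  ∎)))
    where open ≡-Reasoning

sumFin-single : ∀ {n} (u : Fin n) → sumFin (single u) ≡ 1
sumFin-single u = trans (sumFin-cong (λ i → sym (*-identityʳ (single u i)))) (weight-single (const 1) u)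

tokenEmbedding : ∀ {n} (G : SimpleGraph n) {k} → k ≥ 1 → Fin n → GraphHom (toGraph G) (supertoken G k)
tokenEmbedding G {k} k≥1 w = record
  { vertexMap = λ u → S ⊎ₘ single u , size u
  ; preserves = λ {u} {v} uv → S , u , v , uv , (λ _ → refl) , (λ _ → refl)
  }
  where
  S : Multiset _
  S i = single w i * (k ∸ 1)

  size : ∀ u → sumFin (S ⊎ₘ single u) ≡ k
  size u = begin
    sumFin (S ⊎ₘ single u)       ≡⟨ sumFin-+ S (single u) ⟩
    sumFin S + sumFin (single u) ≡⟨ cong₂ _+_ (weight-single (const (k ∸ 1)) w) (sumFin-single u) ⟩
    k ∸ 1 + 1                    ≡⟨ m∸n+n≡m k≥1 ⟩
    k                            ∎
    where open ≡-Reasoning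

colorable-of-supertoken : ∀ {n} (G : SimpleGraph n) {k} → k ≥ 1 →
                          ∀ c → Colorable (supertoken G k) c → Colorable (toGraph G) c
colorable-of-supertoken {zero}  G k≥1 c _ = (λ ()) , λ {u} → ⊥-elim (¬Fin0 u)
colorable-of-supertoken {suc n} G k≥1 c   = colorable-pullback (tokenEmbedding G k≥1 zero)

mainTheorem10 : ∀ {n} (G : SimpleGraph n) (k : ℕ) → k ≥ 1 → ∀ (m : ℕ) → IsChromaticNumber (supertoken G k) m ⇔ IsChromaticNumber (toGraph G) m
mainTheorem10 G k k≥1 = isChromaticNumber-⇔ (colorable-of-supertoken G k≥1) (supertoken-colorable G k≥1)
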